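{- Let $G$ be a finite abelian group and let $F$ be a face of the group cone $\mathcal C(G)$. Let \[ H=\{0\}\cup\{h\in G\setminus\{0\} : x_h=0 \text{ for all } x\in F\}. \] Then $H$ is a subgroup of $G$, and there is a Kunz-balanced poset $\preceq$ on the quotient group $G/H$ such that for all $a,b\in G\setminus\{0\}$ with $a+b\neq 0$, the equation $x_a+x_b=x_{a+b}$ holds for every $x\in F$ if and only if $\bar a\preceq \bar a+\bar b$. (Here $\bar x$ denotes the image of $x\in G$ in $G/H$.)
   Context: For a finite abelian group $(G,+)$ with $m=|G|$, the group cone $\mathcal C(G)\subset\mathbb R^{m-1}$ (coordinates indexed by the nonzero elements of $G$) is the set of all $x$ satisfying $x_a+x_b\ge x_{a+b}$ for all $a,b\in G\setminus\{0\}$ with $a+b\neq 0$. A face of a polyhedron is an intersection of some collection of its facets. A Kunz-balanced poset on a finite abelian group $K$ is a partial order $\preceq$ on the set $K$ such that for all $a,b\in K$, $a\preceq b$ implies $b-a\preceq b$ (in particular $0$ is the unique minimal element).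
   Formalization: The group cone $\mathcal C(G)$ and its face F consist of points with rational coordinates, lying in ℚ^(m-1) rather than $\mathbb R^{m-1}$. -}

module Defs where

open import Level using (0ℓ)
open import Data.Nat using (ℕ)
open import Data.Fin using (Fin)
open import Data.Product using (_×_; Σ; ∃)
open import Data.Sum using (_⊎_)
open import Data.Rational using (ℚ; _≤_) renaming (_+_ to _+ℚ_; 0ℚ to 0ℚ)
open import Relation.Nullary using (¬_; Dec)
open import Relation.Binary.PropositionalEquality using (_≡_; _≢_)
open import Function.Bundles using (_↔_; _⇔_)

record FinAbGroup : Set₁ where
  infixl 6 _+_ _-_
  field
    Carrier   : Set
    _+_       : Carrier → Carrier → Carrier
    0#        : Carrier
    -_        : Carrier → Carrier
    +-assoc   : ∀ a b c → (a + b) + c ≡ a + (b + c)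
    +-comm    : ∀ a b → a + b ≡ b + a
    +-identityˡ : ∀ a → 0# + a ≡ a
    +-inverseˡ  : ∀ a → (- a) + a ≡ 0#
    _≟_       : (a b : Carrier) → Dec (a ≡ b)
    order     : ℕ
    enum      : Fin order ↔ Carrier

  _-_ : Carrier → Carrier → Carrier
  a - b = a + (- b)

module _ (G : FinAbGroup) where
  open FinAbGroup G

  -- Points of ℝ^{m-1} (coordinates indexed by nonzero elements), with reals
  -- replaced by ℚ; the unused coordinate at 0 is normalised to 0.
  Point : Set
  Point = Carrier → ℚ

  InCone : Point → Set
  InCone x = (x 0# ≡ 0ℚ) ×
    (∀ a b → a ≢ 0# → b ≢ 0# → a + b ≢ 0# → x (a + b) ≤ x a +ℚ x b)

  InFace : (Carrier → Carrier → Set) → Point → Set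
  InFace S x = InCone x ×
    (∀ a b → a ≢ 0# → b ≢ 0# → a + b ≢ 0# → S a b → x a +ℚ x b ≡ x (a + b))

  InH : (Point → Set) → Carrier → Set
  InH F h = (h ≡ 0#) ⊎ ((h ≢ 0#) × (∀ x → F x → x h ≡ 0ℚ))

  IsSubgroup : (Carrier → Set) → Set
  IsSubgroup P = P 0# × (∀ a b → P a → P b → P (a + b)) × (∀ a → P a → P (- a))

  -- A partial order on the quotient G/P, represented as a relation on G which
  -- is a preorder whose induced equivalence is exactly congruence mod P.
  -- (Such relations correspond bijectively to partial orders on G/P.)
  IsQuotientPoset : (Carrier → Set) → (Carrier → Carrier → Set) → Set
  IsQuotientPoset P R =
    (∀ a → R a a) ×
    (∀ a b c → R a b → R b c → R a c) ×
    (∀ a b → (R a b × R b a) ⇔ P (a - b))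

  IsKunzBalanced : (Carrier → Carrier → Set) → Set
  IsKunzBalanced R = ∀ a b → R a b → R (b - a) b

{-# OPTIONS --safe #-}
-- Only F ⊆ C(G) is used, never that F is a face: everything is proved for a single
-- cone point x and then intersected over F.  Subadditivity of x extends to all u, v
-- with u + v ≠ 0, so x_c ≤ x_a + x_(c-a) for c ≠ 0; call (a, c) tight when equality
-- holds.  Tightness along a → b → c forces it along a → c, so tightness is a preorder
-- (for c = 0 one needs x_a + x_(-a) ≥ 0, which the middle element b provides), and
-- it is Kunz-balanced because its equation is symmetric in a and c - a.  Finiteness
-- of G enters only through -u being a multiple of u: hence x_u ≤ 0 implies
-- x_(-u) ≤ 0, so the zero set of x is a subgroup on whose cosets x is constant, and
-- a, b are mutually tight exactly when x_(a-b) = 0.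
module Submission where

open import Defs
open import Level using (0ℓ)
open import Algebra.Bundles using (AbelianGroup)
import Algebra.Properties.AbelianGroup as AbelianGroupProperties
import Algebra.Properties.Group as GroupProperties
import Algebra.Properties.Monoid.Mult as MonoidMultiplication
open import Data.Fin using (toℕ)
open import Data.Fin.Properties using (pigeonhole)
open import Data.Nat using (suc) renaming (_+_ to _+ℕ_)
open import Data.Nat.Properties using (n<1+n; m≤n⇒∃[o]m+o≡n; +-suc)
open import Data.Product using (_×_; Σ; _,_; proj₁; proj₂; ∃-syntax)
open import Data.Rational using (0ℚ; _≤_) renaming (_+_ to _+ℚ_; -_ to -ℚ_)
import Data.Rational.Properties as ℚ
open import Data.Sum using (_⊎_; inj₁; inj₂)
open import Function.Base using (_∘_)
open import Function.Bundles using (_⇔_; mk⇔; Injection; Equivalence)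
open import Function.Construct.Symmetry using (↔-sym)
open import Function.Properties.Inverse using (↔⇒↣)
open import Relation.Binary.PropositionalEquality
  using (_≡_; _≢_; refl; sym; trans; cong; cong₂; subst; isEquivalence; module ≡-Reasoning)
open import Relation.Nullary using (yes; no)

module ℚ-Group = GroupProperties ℚ.+-0-group

+-cancelˡ-≤ : ∀ p {q r} → p +ℚ q ≤ p +ℚ r → q ≤ r
+-cancelˡ-≤ p {q} {r} p+q≤p+r = begin
  q                    ≡⟨ ℚ-Group.\\-leftDividesʳ p q ⟨
  -ℚ p +ℚ (p +ℚ q)     ≤⟨ ℚ.+-monoʳ-≤ (-ℚ p) p+q≤p+r ⟩
  -ℚ p +ℚ (p +ℚ r)     ≡⟨ ℚ-Group.\\-leftDividesʳ p r ⟩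
  r                    ∎
  where open ℚ.≤-Reasoning

p+q≡0⇒p≤0⊎q≤0 : ∀ {p q} → p +ℚ q ≡ 0ℚ → p ≤ 0ℚ ⊎ q ≤ 0ℚ
p+q≡0⇒p≤0⊎q≤0 {p} {q} p+q≡0 with ℚ.≤-total p 0ℚ
... | inj₁ p≤0 = inj₁ p≤0
... | inj₂ 0≤p = inj₂ (begin
  q          ≡⟨ ℚ.+-identityˡ q ⟨
  0ℚ +ℚ q    ≤⟨ ℚ.+-monoˡ-≤ q 0≤p ⟩
  p +ℚ q     ≡⟨ p+q≡0 ⟩
  0ℚ         ∎)
  where open ℚ.≤-Reasoning

p≤0∧q≤0∧p+q≡0⇒p≡0 : ∀ {p q} → p ≤ 0ℚ → q ≤ 0ℚ → p +ℚ q ≡ 0ℚ → p ≡ 0ℚ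
p≤0∧q≤0∧p+q≡0⇒p≡0 {p} {q} p≤0 q≤0 p+q≡0 = ℚ.≤-antisym p≤0 (begin
  0ℚ         ≡⟨ p+q≡0 ⟨
  p +ℚ q     ≤⟨ ℚ.+-monoʳ-≤ p q≤0 ⟩
  p +ℚ 0ℚ    ≡⟨ ℚ.+-identityʳ p ⟩
  p          ∎)
  where open ℚ.≤-Reasoning

module FinAbGroupProperties (G : FinAbGroup) where
  open FinAbGroup G

  abelianGroup : AbelianGroup 0ℓ 0ℓ
  abelianGroup = record
    { isAbelianGroup = record
      { isGroup = record
        { isMonoid = record
          { isSemigroup = record
            { isMagma = record { isEquivalence = isEquivalence ; ∙-cong = cong₂ _+_ }
            ; assoc = +-assoc
            }
          ; identity = +-identityˡ , λ a → trans (+-comm a 0#) (+-identityˡ a)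
          }
        ; inverse = +-inverseˡ , λ a → trans (+-comm a (- a)) (+-inverseˡ a)
        ; ⁻¹-cong = cong (-_)
        }
      ; comm = +-comm
      }
    }

  open AbelianGroup abelianGroup public using (identityʳ; inverseʳ)
  open AbelianGroupProperties abelianGroup public
  open MonoidMultiplication (AbelianGroup.monoid abelianGroup) public
    using (×-homo-+) renaming (_×_ to _·_)
  open Injection (↔⇒↣ (↔-sym enum)) using () renaming (to to index; injective to index-injective)
  open ≡-Reasoning

  finite-order : ∀ u → ∃[ d ] suc d · u ≡ 0#
  finite-order u =
    let i , j , i<j , same = pigeonhole (n<1+n order) (λ k → index (toℕ k · u))
        d , 1+i+d≡j = m≤n⇒∃[o]m+o≡n i<j
    in d , ∙-cancelˡ (toℕ i · u) _ _ (begin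
      toℕ i · u + suc d · u    ≡⟨ ×-homo-+ u (toℕ i) (suc d) ⟨
      (toℕ i +ℕ suc d) · u     ≡⟨ cong (_· u) (trans (+-suc (toℕ i) d) 1+i+d≡j) ⟩
      toℕ j · u                ≡⟨ index-injective same ⟨
      toℕ i · u                ≡⟨ identityʳ (toℕ i · u) ⟨
      toℕ i · u + 0#           ∎)

  neg-multiple : ∀ u → ∃[ d ] d · u ≡ - u
  neg-multiple u = let d , [1+d]·u≡0 = finite-order u in d , inverseʳ-unique u (d · u) [1+d]·u≡0

  x+[y-x]≡y : ∀ x y → x + (y - x) ≡ y
  x+[y-x]≡y x y = trans (+-comm x (y - x)) (//-rightDividesˡ x y)

  x-[x-y]≡y : ∀ x y → x - (x - y) ≡ y
  x-[x-y]≡y x y = trans (cong (x +_) (⁻¹-anti-homo-// x y)) (x+[y-x]≡y x y)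

  [y-x]+[z-y]≡z-x : ∀ x y z → (y - x) + (z - y) ≡ z - x
  [y-x]+[z-y]≡z-x x y z = begin
    (y - x) + (z - y)    ≡⟨ +-comm (y - x) (z - y) ⟩
    (z - y) + (y - x)    ≡⟨ +-assoc (z - y) y (- x) ⟨
    (z - y) + y - x      ≡⟨ cong (_- x) (//-rightDividesˡ y z) ⟩
    z - x                ∎

module _ (G : FinAbGroup) where
  open FinAbGroup G
  open FinAbGroupProperties G using (x-[x-y]≡y)
  open ≡-Reasoning

  Tight : Point G → Carrier → Carrier → Set
  Tight x a c = x a +ℚ x (c - a) ≡ x c

  tight-balanced : ∀ x {a b} → Tight x a b → Tight x (b - a) b
  tight-balanced x {a} {b} a⪯b = begin
    x (b - a) +ℚ x (b - (b - a))   ≡⟨ cong (λ v → x (b - a) +ℚ x v) (x-[x-y]≡y b a) ⟩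
    x (b - a) +ℚ x a               ≡⟨ ℚ.+-comm (x (b - a)) (x a) ⟩
    x a +ℚ x (b - a)               ≡⟨ a⪯b ⟩
    x b                            ∎

module ConePoint {G : FinAbGroup} {x : Point G} (x∈C : InCone G x) where
  open FinAbGroup G
  open FinAbGroupProperties G
  open ℚ.≤-Reasoning

  x0≡0 : x 0# ≡ 0ℚ
  x0≡0 = proj₁ x∈C

  subadditive : ∀ {w} u v → u + v ≡ w → w ≢ 0# → x w ≤ x u +ℚ x v
  subadditive u v refl u+v≢0 with u ≟ 0# | v ≟ 0#
  ... | yes refl | _ = begin
    x (0# + v)      ≡⟨ cong x (+-identityˡ v) ⟩
    x v             ≡⟨ ℚ.+-identityˡ (x v) ⟨
    0ℚ +ℚ x v       ≡⟨ cong (_+ℚ x v) x0≡0 ⟨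
    x 0# +ℚ x v     ∎
  ... | no _ | yes refl = begin
    x (u + 0#)      ≡⟨ cong x (identityʳ u) ⟩
    x u             ≡⟨ ℚ.+-identityʳ (x u) ⟨
    x u +ℚ 0ℚ       ≡⟨ cong (x u +ℚ_) x0≡0 ⟨
    x u +ℚ x 0#     ∎
  ... | no u≢0 | no v≢0 = proj₂ x∈C u v u≢0 v≢0 u+v≢0

  nonpos-multiple : ∀ {u} → x u ≤ 0ℚ → ∀ k → x (k · u) ≤ 0ℚ
  nonpos-multiple xu≤0 0 = ℚ.≤-reflexive x0≡0
  nonpos-multiple {u} xu≤0 (suc k) with (u + k · u) ≟ 0#
  ... | yes sum≡0 = ℚ.≤-reflexive (trans (cong x sum≡0) x0≡0)
  ... | no sum≢0 = begin
    x (u + k · u)          ≤⟨ subadditive u (k · u) refl sum≢0 ⟩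
    x u +ℚ x (k · u)       ≤⟨ ℚ.+-mono-≤ xu≤0 (nonpos-multiple xu≤0 k) ⟩
    0ℚ +ℚ 0ℚ               ≡⟨ ℚ.+-identityˡ 0ℚ ⟩
    0ℚ                     ∎

  nonpos-neg : ∀ {u} → x u ≤ 0ℚ → x (- u) ≤ 0ℚ
  nonpos-neg {u} xu≤0 =
    let d , d·u≡-u = neg-multiple u in subst (λ v → x v ≤ 0ℚ) d·u≡-u (nonpos-multiple xu≤0 d)

  null-neg : ∀ {h} → x h ≡ 0ℚ → x (- h) ≡ 0ℚ
  null-neg {h} xh≡0 = ℚ.≤-antisym (nonpos-neg (ℚ.≤-reflexive xh≡0)) 0≤x[-h]
    where
    0≤x[-h] : 0ℚ ≤ x (- h)
    0≤x[-h] with h ≟ 0#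
    ... | yes h≡0 = ℚ.≤-reflexive (sym (trans (cong x (trans (cong (-_) h≡0) ε⁻¹≈ε)) x0≡0))
    ... | no h≢0 = begin
      0ℚ                       ≡⟨ xh≡0 ⟨
      x h                      ≤⟨ subadditive (h + h) (- h) (//-rightDividesʳ h h) h≢0 ⟩
      x (h + h) +ℚ x (- h)     ≤⟨ ℚ.+-monoˡ-≤ (x (- h)) x[h+h]≤0 ⟩
      0ℚ +ℚ x (- h)            ≡⟨ ℚ.+-identityˡ (x (- h)) ⟩
      x (- h)                  ∎
      where
      x[h+h]≤0 : x (h + h) ≤ 0ℚ
      x[h+h]≤0 = subst (λ v → x v ≤ 0ℚ) (cong (h +_) (identityʳ h))
                   (nonpos-multiple (ℚ.≤-reflexive xh≡0) 2)

  null-translate : ∀ {h} → x h ≡ 0ℚ → ∀ a → x (a + h) ≡ x a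
  null-translate {h} xh≡0 a = ℚ.≤-antisym upper lower
    where
    upper : x (a + h) ≤ x a
    upper with (a + h) ≟ 0#
    ... | yes a+h≡0 = begin
      x (a + h)            ≡⟨ cong x a+h≡0 ⟩
      x 0#                 ≡⟨ x0≡0 ⟩
      0ℚ                   ≡⟨ null-neg xh≡0 ⟨
      x (- h)              ≡⟨ cong x (inverseˡ-unique a h a+h≡0) ⟨
      x a                  ∎
    ... | no a+h≢0 = begin
      x (a + h)            ≤⟨ subadditive a h refl a+h≢0 ⟩
      x a +ℚ x h           ≡⟨ cong (x a +ℚ_) xh≡0 ⟩
      x a +ℚ 0ℚ            ≡⟨ ℚ.+-identityʳ (x a) ⟩
      x a                  ∎
    lower : x a ≤ x (a + h)
    lower with a ≟ 0#
    ... | yes a≡0 = begin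
      x a                  ≡⟨ cong x a≡0 ⟩
      x 0#                 ≡⟨ x0≡0 ⟩
      0ℚ                   ≡⟨ xh≡0 ⟨
      x h                  ≡⟨ cong x (trans (cong (_+ h) a≡0) (+-identityˡ h)) ⟨
      x (a + h)            ∎
    ... | no a≢0 = begin
      x a                       ≤⟨ subadditive (a + h) (- h) (//-rightDividesʳ h a) a≢0 ⟩
      x (a + h) +ℚ x (- h)      ≡⟨ cong (x (a + h) +ℚ_) (null-neg xh≡0) ⟩
      x (a + h) +ℚ 0ℚ           ≡⟨ ℚ.+-identityʳ (x (a + h)) ⟩
      x (a + h)                 ∎

  null-of-pair-sum : ∀ {u} → x u +ℚ x (- u) ≡ 0ℚ → x u ≡ 0ℚ
  null-of-pair-sum {u} sum≡0 with p+q≡0⇒p≤0⊎q≤0 sum≡0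
  ... | inj₁ xu≤0 = p≤0∧q≤0∧p+q≡0⇒p≡0 xu≤0 (nonpos-neg xu≤0) sum≡0
  ... | inj₂ x[-u]≤0 = p≤0∧q≤0∧p+q≡0⇒p≡0 xu≤0 x[-u]≤0 sum≡0
    where
    xu≤0 : x u ≤ 0ℚ
    xu≤0 = subst (λ v → x v ≤ 0ℚ) (⁻¹-involutive u) (nonpos-neg x[-u]≤0)

  -- The third element b is essential: in ℤ/2ℤ the cone imposes no inequality,
  -- and x_1 < 0 is allowed.
  pair-sum-nonneg : ∀ {u b} → b ≢ 0# → b ≢ u → 0ℚ ≤ x u +ℚ x (- u)
  pair-sum-nonneg {u} {b} b≢0 b≢u = +-cancelˡ-≤ (x b) (begin
    x b +ℚ 0ℚ                   ≡⟨ ℚ.+-identityʳ (x b) ⟩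
    x b                         ≤⟨ subadditive (b - u) u (//-rightDividesˡ u b) b≢0 ⟩
    x (b - u) +ℚ x u            ≤⟨ ℚ.+-monoˡ-≤ (x u) x[b-u]≤xb+x[-u] ⟩
    (x b +ℚ x (- u)) +ℚ x u     ≡⟨ ℚ.+-assoc (x b) (x (- u)) (x u) ⟩
    x b +ℚ (x (- u) +ℚ x u)     ≡⟨ cong (x b +ℚ_) (ℚ.+-comm (x (- u)) (x u)) ⟩
    x b +ℚ (x u +ℚ x (- u))     ∎)
    where
    x[b-u]≤xb+x[-u] : x (b - u) ≤ x b +ℚ x (- u)
    x[b-u]≤xb+x[-u] = subadditive b (- u) refl (b≢u ∘ x∙y⁻¹≈ε⇒x≈y b u)

  tight-refl : ∀ a → Tight G x a a
  tight-refl a = begin-equality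
    x a +ℚ x (a - a)    ≡⟨ cong (λ v → x a +ℚ x v) (inverseʳ a) ⟩
    x a +ℚ x 0#         ≡⟨ cong (x a +ℚ_) x0≡0 ⟩
    x a +ℚ 0ℚ           ≡⟨ ℚ.+-identityʳ (x a) ⟩
    x a                 ∎

  tight-trans : ∀ {a b c} → Tight G x a b → Tight G x b c → Tight G x a c
  tight-trans {a} {b} {c} a⪯b b⪯c with a ≟ b | b ≟ c | a ≟ c
  ... | yes refl | _ | _ = b⪯c
  ... | _ | yes refl | _ = a⪯b
  ... | _ | _ | yes refl = tight-refl a
  ... | no a≢b | no b≢c | no a≢c = ℚ.≤-antisym upper lower
    where
    upper : x a +ℚ x (c - a) ≤ x c
    upper = begin
      x a +ℚ x (c - a)                   ≤⟨ ℚ.+-monoʳ-≤ (x a) x[c-a]≤x[b-a]+x[c-b] ⟩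
      x a +ℚ (x (b - a) +ℚ x (c - b))    ≡⟨ ℚ.+-assoc (x a) (x (b - a)) (x (c - b)) ⟨
      (x a +ℚ x (b - a)) +ℚ x (c - b)    ≡⟨ cong (_+ℚ x (c - b)) a⪯b ⟩
      x b +ℚ x (c - b)                   ≡⟨ b⪯c ⟩
      x c                                ∎
      where
      x[c-a]≤x[b-a]+x[c-b] : x (c - a) ≤ x (b - a) +ℚ x (c - b)
      x[c-a]≤x[b-a]+x[c-b] =
        subadditive (b - a) (c - b) ([y-x]+[z-y]≡z-x a b c) (a≢c ∘ sym ∘ x∙y⁻¹≈ε⇒x≈y c a)
    lower : x c ≤ x a +ℚ x (c - a)
    lower with c ≟ 0#
    ... | no c≢0 = subadditive a (c - a) (x+[y-x]≡y a c) c≢0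
    ... | yes c≡0 = begin
      x c                  ≡⟨ cong x c≡0 ⟩
      x 0#                 ≡⟨ x0≡0 ⟩
      0ℚ                   ≤⟨ pair-sum-nonneg (λ b≡0 → b≢c (trans b≡0 (sym c≡0))) (a≢b ∘ sym) ⟩
      x a +ℚ x (- a)       ≡⟨ cong (λ v → x a +ℚ x v) c-a≡-a ⟨
      x a +ℚ x (c - a)     ∎
      where
      c-a≡-a : c - a ≡ - a
      c-a≡-a = trans (cong (_- a) c≡0) (+-identityˡ (- a))

  null⇒tight : ∀ {a c} → x (c - a) ≡ 0ℚ → Tight G x a c
  null⇒tight {a} {c} x[c-a]≡0 = begin-equality
    x a +ℚ x (c - a)     ≡⟨ cong (x a +ℚ_) x[c-a]≡0 ⟩
    x a +ℚ 0ℚ            ≡⟨ ℚ.+-identityʳ (x a) ⟩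
    x a                  ≡⟨ null-translate x[c-a]≡0 a ⟨
    x (a + (c - a))      ≡⟨ cong x (x+[y-x]≡y a c) ⟩
    x c                  ∎

  tight-both⇔null : ∀ {a b} → (Tight G x a b × Tight G x b a) ⇔ (x (a - b) ≡ 0ℚ)
  tight-both⇔null {a} {b} = mk⇔ to from
    where
    to : Tight G x a b × Tight G x b a → x (a - b) ≡ 0ℚ
    to (a⪯b , b⪯a) = null-of-pair-sum (begin-equality
      x (a - b) +ℚ x (- (a - b))   ≡⟨ cong (λ v → x (a - b) +ℚ x v) (⁻¹-anti-homo-// a b) ⟩
      x (a - b) +ℚ x (b - a)       ≡⟨ ℚ-Group.∙-cancelˡ (x a) _ _ round-trip ⟩
      0ℚ                           ∎)
      where
      round-trip : x a +ℚ (x (a - b) +ℚ x (b - a)) ≡ x a +ℚ 0ℚ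
      round-trip = begin-equality
        x a +ℚ (x (a - b) +ℚ x (b - a))    ≡⟨ cong (x a +ℚ_) (ℚ.+-comm (x (a - b)) (x (b - a))) ⟩
        x a +ℚ (x (b - a) +ℚ x (a - b))    ≡⟨ ℚ.+-assoc (x a) (x (b - a)) (x (a - b)) ⟨
        (x a +ℚ x (b - a)) +ℚ x (a - b)    ≡⟨ cong (_+ℚ x (a - b)) a⪯b ⟩
        x b +ℚ x (a - b)                   ≡⟨ b⪯a ⟩
        x a                                ≡⟨ ℚ.+-identityʳ (x a) ⟨
        x a +ℚ 0ℚ                          ∎
    from : x (a - b) ≡ 0ℚ → Tight G x a b × Tight G x b a
    from x[a-b]≡0 = null⇒tight x[b-a]≡0 , null⇒tight x[a-b]≡0
      where
      x[b-a]≡0 : x (b - a) ≡ 0ℚ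
      x[b-a]≡0 = trans (cong x (sym (⁻¹-anti-homo-// a b))) (null-neg x[a-b]≡0)

module ConeSubset (G : FinAbGroup) (F : Point G → Set) (F⊆C : ∀ {x} → F x → InCone G x) where
  open FinAbGroup G
  open FinAbGroupProperties G using (xyx⁻¹≈y)
  open module PointOfF {x} (x∈F : F x) = ConePoint {G} {x} (F⊆C x∈F)
    using (x0≡0; null-neg; null-translate; tight-refl; tight-trans; tight-both⇔null)

  VanishesOnF : Carrier → Set
  VanishesOnF h = ∀ x → F x → x h ≡ 0ℚ

  InH⇒VanishesOnF : ∀ {h} → InH G F h → VanishesOnF h
  InH⇒VanishesOnF (inj₁ refl) x x∈F = x0≡0 x∈F
  InH⇒VanishesOnF (inj₂ (_ , vanishes)) = vanishes

  VanishesOnF⇒InH : ∀ {h} → VanishesOnF h → InH G F h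
  VanishesOnF⇒InH {h} vanishes with h ≟ 0#
  ... | yes h≡0 = inj₁ h≡0
  ... | no h≢0 = inj₂ (h≢0 , vanishes)

  InH-isSubgroup : IsSubgroup G (InH G F)
  InH-isSubgroup = inj₁ refl , +-closed , neg-closed
    where
    +-closed : ∀ a b → InH G F a → InH G F b → InH G F (a + b)
    +-closed a b a∈H b∈H = VanishesOnF⇒InH λ x x∈F →
      trans (null-translate x∈F (InH⇒VanishesOnF b∈H x x∈F) a) (InH⇒VanishesOnF a∈H x x∈F)
    neg-closed : ∀ a → InH G F a → InH G F (- a)
    neg-closed a a∈H = VanishesOnF⇒InH λ x x∈F → null-neg x∈F (InH⇒VanishesOnF a∈H x x∈F)

  _⪯_ : Carrier → Carrier → Set
  a ⪯ c = ∀ x → F x → Tight G x a c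

  ⪯-isQuotientPoset : IsQuotientPoset G (InH G F) _⪯_
  ⪯-isQuotientPoset = ⪯-refl , ⪯-trans , ⪯-antisym-mod-H
    where
    ⪯-refl : ∀ a → a ⪯ a
    ⪯-refl a x x∈F = tight-refl x∈F a
    ⪯-trans : ∀ a b c → a ⪯ b → b ⪯ c → a ⪯ c
    ⪯-trans a b c a⪯b b⪯c x x∈F = tight-trans x∈F (a⪯b x x∈F) (b⪯c x x∈F)
    ⪯-antisym-mod-H : ∀ a b → (a ⪯ b × b ⪯ a) ⇔ InH G F (a - b)
    ⪯-antisym-mod-H a b = mk⇔
      (λ (a⪯b , b⪯a) → VanishesOnF⇒InH λ x x∈F →
        Equivalence.to (tight-both⇔null x∈F) (a⪯b x x∈F , b⪯a x x∈F))
      (λ a-b∈H →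
        (λ x x∈F → proj₁ (from-null x x∈F (InH⇒VanishesOnF a-b∈H x x∈F))) ,
        (λ x x∈F → proj₂ (from-null x x∈F (InH⇒VanishesOnF a-b∈H x x∈F))))
      where
      from-null : ∀ x → F x → x (a - b) ≡ 0ℚ → Tight G x a b × Tight G x b a
      from-null x x∈F = Equivalence.from (tight-both⇔null x∈F)

  ⪯-isKunzBalanced : IsKunzBalanced G _⪯_
  ⪯-isKunzBalanced a b a⪯b x x∈F = tight-balanced G x (a⪯b x x∈F)

  tight-on-F⇔⪯ : ∀ a b → (∀ x → F x → x a +ℚ x b ≡ x (a + b)) ⇔ a ⪯ (a + b)
  tight-on-F⇔⪯ a b = mk⇔
    (λ tight x x∈F → subst (λ v → x a +ℚ x v ≡ x (a + b)) (sym (xyx⁻¹≈y a b)) (tight x x∈F))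
    (λ a⪯a+b x x∈F → subst (λ v → x a +ℚ x v ≡ x (a + b)) (xyx⁻¹≈y a b) (a⪯a+b x x∈F))

theorem3p3 : (G : FinAbGroup) → (S : FinAbGroup.Carrier G → FinAbGroup.Carrier G → Set) →
    IsSubgroup G (InH G (InFace G S)) ×
    Σ (FinAbGroup.Carrier G → FinAbGroup.Carrier G → Set) (λ R →
      IsQuotientPoset G (InH G (InFace G S)) R ×
      IsKunzBalanced G R ×
      (∀ a b → a ≢ FinAbGroup.0# G → b ≢ FinAbGroup.0# G → FinAbGroup._+_ G a b ≢ FinAbGroup.0# G →
        ((∀ x → InFace G S x → x a +ℚ x b ≡ x (FinAbGroup._+_ G a b)) ⇔ R a (FinAbGroup._+_ G a b))))
theorem3p3 G S =
  InH-isSubgroup , _⪯_ , ⪯-isQuotientPoset , ⪯-isKunzBalanced , λ a b _ _ _ → tight-on-F⇔⪯ a b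
  where open ConeSubset G (InFace G S) proj₁
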